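{- The modal logic $\mathsf{S4}$ is sound for reflexive provability models with necessitation, local soundness and local completeness: if $\mathsf{S4}\vdash A$ and $\mathcal P$ is such a model, then $\mathcal P,w\Vdash A$ for every world $w$. Moreover, the same holds if the requirement of necessitation is replaced by transitivity of the accessibility relation.
   Context: $\mathsf{S4}$ is $\mathsf K$ (the smallest normal modal logic) plus $\Box A\to\Box\Box A$ and $\Box A\to A$. Language $\mathcal L_\Box$: formulas built from atomic propositions and $\bot$ using $\to$ and a unary $\Box$. A formula is purely modal if it is a Boolean combination of formulas $\Box B$. A theory is a pair of a set of axioms and a set of inference rules (finitely many premises, one conclusion); $\mathsf T\vdash A$ means derivability from axioms by rules. A theory is classical if modus ponens is one of its rules and all classical tautologies are derivable. A provability pre-model is $\mathcal P=(W,\sqsubset,\{L_w\}_{w\in W^\sqsubset},V)$ with $W$ nonempty, $\sqsubset$ a binary relation on $W$, $V\subseteq W\times\mathrm{atoms}$, $W^\sqsubset=\{u:\exists v\,(v\sqsubset u)\}$, and a theory $L_w$ for each $w\in W^\sqsubset$. Satisfaction: atoms via $V$, $\bot$ never holds, $\to$ classical, $\mathcal P,w\Vdash\Box A$ iff $L_u\vdash A$ for all $u$ with $w\sqsubset u$. With $\sqsubset^+$ the transitive closure, $\mathcal P,w\Vdash^+A$ iff there is $u\sqsubset w$ with $\mathcal P,v\Vdash A$ for all $v$ such that $u\sqsubset^+v$. A provability model is a pre-model in which every $L_w$ is classical and which satisfies modal completeness: for every $w\in W^\sqsubset$ and purely modal $A$, $\mathcal P,w\Vdash^+A$ implies $L_w\vdash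 A$. Necessitation: every $L_w$ has the rule "from $A$ infer $\Box A$". Local completeness: for every $w\in W^\sqsubset$ and every formula $A$ (not necessarily purely modal), $\mathcal P,w\Vdash^+A$ implies $L_w\vdash A$. Local soundness: for every $w\in W^\sqsubset$ and every $A$, $L_w\vdash A$ implies $\mathcal P,w\Vdash A$. Reflexive/transitive refer to $\sqsubset$. -}

module Defs where

open import Data.Nat using (ℕ)
open import Data.Bool using (Bool; true; false; _∨_; not)
open import Data.List using (List; []; _∷_)
open import Data.List.Relation.Unary.All using (All)
open import Data.Product using (Σ; _×_; _,_)
open import Data.Empty using (⊥)
open import Relation.Binary.PropositionalEquality using (_≡_)
open import Relation.Binary.Construct.Closure.Transitive using (TransClosure)
open import Level using (0ℓ)
open import Axiom.ExcludedMiddle using (ExcludedMiddle)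

infixr 5 _⇒_
data Formula : Set where
  atom : ℕ → Formula
  ⊥'   : Formula
  _⇒_  : Formula → Formula → Formula
  □    : Formula → Formula

-- Classical (propositional) truth value: atoms and boxed formulas are
-- treated as propositional variables.
tv : (ℕ → Bool) → (Formula → Bool) → Formula → Bool
tv f g (atom p) = f p
tv f g ⊥'       = false
tv f g (A ⇒ B)  = not (tv f g A) ∨ tv f g B
tv f g (□ A)    = g A

Tautology : Formula → Set
Tautology A = ∀ (f : ℕ → Bool) (g : Formula → Bool) → tv f g A ≡ true

data PurelyModal : Formula → Set where
  pm-□ : ∀ B → PurelyModal (□ B)
  pm-⊥ : PurelyModal ⊥'
  pm-⇒ : ∀ {A B} → PurelyModal A → PurelyModal B → PurelyModal (A ⇒ B)

record Theory : Set₁ where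
  field
    Axiom : Formula → Set
    Rule  : List Formula → Formula → Set
open Theory public

data _⊢_ (T : Theory) : Formula → Set where
  ax   : ∀ {A} → Axiom T A → T ⊢ A
  rule : ∀ {Γ A} → Rule T Γ A → All (T ⊢_) Γ → T ⊢ A

Classical : Theory → Set
Classical T = (∀ A B → Rule T (A ∷ (A ⇒ B) ∷ []) B)
            × (∀ A → Tautology A → T ⊢ A)

data S4-Axiom : Formula → Set where
  taut : ∀ {A} → Tautology A → S4-Axiom A
  K    : ∀ A B → S4-Axiom (□ (A ⇒ B) ⇒ □ A ⇒ □ B)
  ax4  : ∀ A → S4-Axiom (□ A ⇒ □ (□ A))
  axT  : ∀ A → S4-Axiom (□ A ⇒ A)

data S4-Rule : List Formula → Formula → Set where
  mp  : ∀ A B → S4-Rule (A ∷ (A ⇒ B) ∷ []) B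
  nec : ∀ A → S4-Rule (A ∷ []) (□ A)

S4 : Theory
S4 = record { Axiom = S4-Axiom ; Rule = S4-Rule }

-- Provability pre-model.  L is given as a total function W → Theory;
-- only its values on W^⊏ are ever consulted.
record PreModel : Set₁ where
  field
    W   : Set
    w₀  : W                       -- W is nonempty
    _⊏_ : W → W → Set
    L   : W → Theory
    V   : W → ℕ → Set
open PreModel public

InW⊏ : (P : PreModel) → W P → Set
InW⊏ P w = Σ (W P) (λ v → _⊏_ P v w)

_,_⊩_ : (P : PreModel) → W P → Formula → Set
P , w ⊩ atom p = V P w p
P , w ⊩ ⊥'     = ⊥
P , w ⊩ (A ⇒ B) = P , w ⊩ A → P , w ⊩ B
P , w ⊩ □ A    = ∀ u → _⊏_ P w u → L P u ⊢ A

_,_⊩⁺_ : (P : PreModel) → W P → Formula → Set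
P , w ⊩⁺ A = Σ (W P) λ u → _⊏_ P u w ×
               (∀ v → TransClosure (_⊏_ P) u v → P , v ⊩ A)

ModalComplete : PreModel → Set
ModalComplete P = ∀ w → InW⊏ P w → ∀ A → PurelyModal A → P , w ⊩⁺ A → L P w ⊢ A

IsProvModel : PreModel → Set
IsProvModel P = (∀ w → InW⊏ P w → Classical (L P w)) × ModalComplete P

Necessitation : PreModel → Set
Necessitation P = ∀ w → InW⊏ P w → ∀ A → Rule (L P w) (A ∷ []) (□ A)

LocallyComplete : PreModel → Set
LocallyComplete P = ∀ w → InW⊏ P w → ∀ A → P , w ⊩⁺ A → L P w ⊢ A

LocallySound : PreModel → Set
LocallySound P = ∀ w → InW⊏ P w → ∀ A → L P w ⊢ A → P , w ⊩ A

IsReflexive : PreModel → Set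
IsReflexive P = ∀ w → _⊏_ P w w

IsTransitive : PreModel → Set
IsTransitive P = ∀ u v w → _⊏_ P u v → _⊏_ P v w → _⊏_ P u w

-- Classical metatheory (the paper's semantics is classical)
LEM : Set₁
LEM = ExcludedMiddle 0ℓ

-- Tautologies are
-- valid because, classically, satisfaction at a world is a Boolean valuation
-- that treats boxed formulas as atoms. K holds since the theories at accessible
-- worlds are closed under modus ponens, T by reflexivity and local soundness,
-- and necessitation preserves validity by local completeness. Axiom 4 follows
-- either from the necessitation rule of the theories or, for transitive models,
-- from local completeness: transitivity makes □A, true at w, true at every
-- world in the transitive closure of the successors of w.
module Submission where

open import Defs
open import Data.Product using (_×_; _,_; proj₁)
open import Data.Nat using (ℕ)
open import Data.Bool using (Bool)
open import Data.List.Relation.Unary.All using ([]; _∷_)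
open import Relation.Nullary using (does; proof)
open import Relation.Nullary.Reflects using (Reflects; ofⁿ; invert; _→-reflects_)
open import Relation.Binary.PropositionalEquality using (subst)
open import Relation.Binary.Construct.Closure.Transitive using (TransClosure; transitive⁻)

Valid : PreModel → Formula → Set
Valid P A = ∀ w → P , w ⊩ A

⊢-mp : ∀ {T A B} → Classical T → T ⊢ A → T ⊢ (A ⇒ B) → T ⊢ B
⊢-mp {A = A} {B} (modusPonens , _) ⊢A ⊢A⇒B = rule (modusPonens A B) (⊢A ∷ ⊢A⇒B ∷ [])

module _ (lem : LEM) (P : PreModel) (w : W P) where

  ⊩-valuation : ℕ → Bool
  ⊩-valuation p = does (lem {V P w p})

  ⊩□-valuation : Formula → Bool
  ⊩□-valuation B = does (lem {P , w ⊩ □ B})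

  tv-reflects-⊩ : ∀ A → Reflects (P , w ⊩ A) (tv ⊩-valuation ⊩□-valuation A)
  tv-reflects-⊩ (atom p) = proof (lem {V P w p})
  tv-reflects-⊩ ⊥'       = ofⁿ λ ()
  tv-reflects-⊩ (A ⇒ B)  = tv-reflects-⊩ A →-reflects tv-reflects-⊩ B
  tv-reflects-⊩ (□ B)    = proof (lem {P , w ⊩ □ B})

  tautology-⊩ : ∀ A → Tautology A → P , w ⊩ A
  tautology-⊩ A tautology =
    invert (subst (Reflects _) (tautology ⊩-valuation ⊩□-valuation) (tv-reflects-⊩ A))

module _ (P : PreModel) where

  K-valid : (∀ w → InW⊏ P w → Classical (L P w)) →
            ∀ A B → Valid P (□ (A ⇒ B) ⇒ □ A ⇒ □ B)
  K-valid classical A B w ⊩□A⇒B ⊩□A u w⊏u =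
    ⊢-mp (classical u (w , w⊏u)) (⊩□A u w⊏u) (⊩□A⇒B u w⊏u)

  T-valid : IsReflexive P → LocallySound P → ∀ A → Valid P (□ A ⇒ A)
  T-valid refl⊏ sound A w ⊩□A = sound w (w , refl⊏ w) A (⊩□A w (refl⊏ w))

  nec-preserves-valid : LocallyComplete P → ∀ {A} → Valid P A → Valid P (□ A)
  nec-preserves-valid complete {A} ⊨A w u w⊏u =
    complete u (w , w⊏u) A (w , w⊏u , λ v _ → ⊨A v)

  four-valid-by-necessitation : Necessitation P → ∀ A → Valid P (□ A ⇒ □ (□ A))
  four-valid-by-necessitation necessitation A w ⊩□A u w⊏u =
    rule (necessitation u (w , w⊏u) A) (⊩□A u w⊏u ∷ [])

  four-valid-by-transitivity : IsTransitive P → LocallyComplete P →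
                               ∀ A → Valid P (□ A ⇒ □ (□ A))
  four-valid-by-transitivity trans complete A w ⊩□A u w⊏u =
    complete u (w , w⊏u) (□ A) (w , w⊏u , ⊩□A-after)
    where
    ⊩□A-after : ∀ v → TransClosure (_⊏_ P) w v → P , v ⊩ □ A
    ⊩□A-after v w⊏⁺v x v⊏x =
      ⊩□A x (trans w v x (transitive⁻ (_⊏_ P) (λ {a b c} → trans a b c) w⊏⁺v) v⊏x)

  S4-sound : LEM → (∀ w → InW⊏ P w → Classical (L P w)) → IsReflexive P →
             LocallySound P → LocallyComplete P →
             (∀ A → Valid P (□ A ⇒ □ (□ A))) →
             ∀ A → S4 ⊢ A → Valid P A
  S4-sound lem classical refl⊏ sound complete four _ = go
    where
    go : ∀ {A} → S4 ⊢ A → Valid P A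
    go (ax (taut {A} t))                = λ w → tautology-⊩ lem P w A t
    go (ax (K A B))                     = K-valid classical A B
    go (ax (ax4 A))                     = four A
    go (ax (axT A))                     = T-valid refl⊏ sound A
    go (rule (mp _ _) (⊢A ∷ ⊢A⇒B ∷ [])) = λ w → go ⊢A⇒B w (go ⊢A w)
    go (rule (nec _) (⊢A ∷ []))         = nec-preserves-valid complete (go ⊢A)

theorem3p11 : LEM →
    ((P : PreModel) → IsProvModel P → IsReflexive P → Necessitation P →
      LocallySound P → LocallyComplete P →
      ∀ A → S4 ⊢ A → ∀ w → P , w ⊩ A)
    ×
    ((P : PreModel) → IsProvModel P → IsReflexive P → IsTransitive P →
      LocallySound P → LocallyComplete P →
      ∀ A → S4 ⊢ A → ∀ w → P , w ⊩ A)
theorem3p11 lem =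
    (λ P model refl⊏ necessitation sound complete →
       S4-sound P lem (proj₁ model) refl⊏ sound complete
         (four-valid-by-necessitation P necessitation))
  , (λ P model refl⊏ trans sound complete →
       S4-sound P lem (proj₁ model) refl⊏ sound complete
         (four-valid-by-transitivity P trans complete))
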